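{- Let $n\ge1$ and $S,T\in\mathcal{L}_n$. If $\#T-\#S\notin\{0,1\}$, then $\mu_n(S,T)=0$.
   Context: Let $[k,n]=\{k,\dots,n\}$. $\mathcal{L}_n$ is the set of subsets of $\{1,\dots,n\}$ with $I\le_n J$ iff $\#(I\cap[k,n])\le\#(J\cap[k,n])$ for all $k=1,\dots,n$. $\mu_n$ is its Möbius function ($\mu_n(x,x)=1$, $\mu_n(x,y)=0$ unless $x\le_ny$, $\sum_{x\le_nz\le_ny}\mu_n(x,z)=0$ for $x<_ny$). -}

module Defs where

open import Data.Nat using (ℕ; zero; suc; _≤_; _≤ᵇ_)
open import Data.Nat.Properties using (_≤?_)
open import Data.Bool using (Bool; true; false; if_then_else_; _∧_)
open import Data.Fin using (Fin; toℕ)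
open import Data.Fin.Properties using (all?)
open import Data.Fin.Subset using (Subset; inside; outside)
open import Data.Vec using (Vec; []; _∷_; lookup)
open import Data.List using (List; [_]; _++_; map; allFin)
import Data.List as List
open import Data.Nat.ListAction using (sum)
open import Data.Integer using (ℤ; _+_)
import Data.Integer as ℤ
open import Relation.Nullary using (Dec; does)
open import Relation.Binary.PropositionalEquality using (_≡_)

-- A subset I of {1,…,n} is an element of Subset n; position i : Fin n
-- (0-based) stands for the element toℕ i + 1.

-- #(I ∩ [k,n]) where k = toℕ j + 1, i.e. number of positions i with j ≤ i in I.
suffixCount : ∀ {n} → Subset n → Fin n → ℕ
suffixCount {n} I j =
  sum (map (λ i → if (toℕ j ≤ᵇ toℕ i) ∧ lookup I i then 1 else 0) (allFin n))

_≤L_ : ∀ {n} → Subset n → Subset n → Set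
I ≤L J = ∀ j → suffixCount I j ≤ suffixCount J j

_≤L?_ : ∀ {n} (I J : Subset n) → Dec (I ≤L J)
I ≤L? J = all? (λ j → suffixCount I j ≤? suffixCount J j)

allSubsets : ∀ n → List (Subset n)
allSubsets zero = [ [] ]
allSubsets (suc n) = map (outside ∷_) (allSubsets n) ++ map (inside ∷_) (allSubsets n)

intervalSum : ∀ {n} → (Subset n → Subset n → ℤ) → Subset n → Subset n → ℤ
intervalSum {n} μ x y =
  List.foldr _+_ (ℤ.+ 0)
    (map (λ z → if does (x ≤L? z) ∧ does (z ≤L? y) then μ x z else ℤ.+ 0) (allSubsets n))

IsMobius : ∀ n → (Subset n → Subset n → ℤ) → Set
IsMobius n μ =
  (∀ x → μ x x ≡ ℤ.+ 1)
  × (∀ x y → ¬ (x ≤L y) → μ x y ≡ ℤ.+ 0)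
  × (∀ x y → x ≤L y → ¬ (x ≡ y) → intervalSum μ x y ≡ ℤ.+ 0)
  where
  open import Data.Product using (_×_)
  open import Relation.Nullary using (¬_)

module Submission where

-- Let x ∈ 𝓛_n and call y ∈ 𝓛_n *close to x* if #(y ∩ [k,n]) ≤ #(x ∩ [k,n]) + 1
-- for every k.  The Möbius function μ(x,-) vanishes on every y ≥ x that is not
-- close to x; the corollary is the special case k = 1, where #T ≤ #S + 1 and
-- S ≤ T force #T - #S ∈ {0,1}.
--
-- Let b be the
-- truncation of y at x: the subset whose suffix counts are
-- min(#(y ∩ [k,n]), #(x ∩ [k,n]) + 1).  It is the largest element below y that
-- is close to x, and x < b ≤ y.  Splitting the interval sum over [x,y] into the
-- sum over [x,b] (which is 0) and the sum over the z ∈ [x,y] with z ≰ b, every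
-- z ≠ y in the latter part is not close to x and strictly below y, so μ(x,z)=0
-- by induction; hence 0 = μ(x,y).

open import Defs
open import Data.Nat using (ℕ; zero; suc; _+_; _⊓_; _≤_; _<_; _≤ᵇ_; z≤n; s≤s)
open import Data.Nat.Properties
  using (≤-refl; ≤-trans; ≤-antisym; ≮⇒≥; _<?_; n≤1+n; m≤n+m;
         +-mono-≤; +-mono-≤-<; +-mono-<-≤; m≤n⇒m<n∨m≡n; ⊓-mono-≤; ⊓-glb;
         m⊓n≤m; m⊓n≤n; ⊓-sel; 1+n≢n; 1+n≰n)
open import Data.Nat.Induction using (<-wellFounded)
open import Data.Nat.ListAction using (sum)
open import Data.Bool using (Bool; true; false; if_then_else_; _∧_; not)
import Data.Bool as Bool
open import Data.Fin using (Fin; toℕ)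
import Data.Fin as Fin
open import Data.Fin.Subset using (Subset; ∣_∣; inside; outside)
open import Data.Vec using ([]; _∷_; lookup)
open import Data.Vec.Properties using (≡-dec; ∷-injectiveʳ)
open import Data.List using (List; _++_; map; allFin; foldr)
import Data.List.Properties as List
open import Data.Integer using (ℤ; 0ℤ) renaming (_+_ to _+ℤ_)
import Data.Integer as ℤ
import Data.Integer.Properties as ℤ
open import Algebra.Properties.CommutativeSemigroup ℤ.+-commutativeSemigroup
  using (interchange)
open import Data.Product using (_,_)
open import Data.Sum using (_⊎_; inj₁; inj₂)
open import Function using (_∘_; _on_)
open import Induction.WellFounded using (WellFounded; Acc; acc)
import Relation.Binary.Construct.On as On
open import Relation.Nullary using (¬_; Dec; yes; no; does; contradiction)
open import Relation.Nullary.Decidable using (dec-true; dec-false)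
open import Relation.Binary.PropositionalEquality
  using (_≡_; _≢_; refl; sym; trans; cong; cong₂; subst₂; module ≡-Reasoning)

bit : Bool → ℕ
bit true = 1
bit false = 0

-- suffix I k = #(I ∩ [k+1,n]): the number of elements of I at positions ≥ k.
suffix : ∀ {n} → Subset n → ℕ → ℕ
suffix [] k = 0
suffix (p ∷ I) zero = bit p + suffix I zero
suffix (p ∷ I) (suc k) = suffix I k

∣∣≡suffix : ∀ {n} (I : Subset n) → ∣ I ∣ ≡ suffix I 0
∣∣≡suffix [] = refl
∣∣≡suffix (true ∷ I) = cong suc (∣∣≡suffix I)
∣∣≡suffix (false ∷ I) = ∣∣≡suffix I

suffix-grows : ∀ {n} p (I : Subset n) → suffix I 0 ≤ suffix (p ∷ I) 0
suffix-grows p I = m≤n+m (suffix I 0) (bit p)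

suffix-step : ∀ {n} p (I : Subset n) → suffix (p ∷ I) 0 ≤ suc (suffix I 0)
suffix-step true I = ≤-refl
suffix-step false I = n≤1+n _

member≥ : ∀ {n} → Subset n → ℕ → Fin n → ℕ
member≥ I k i = if (k ≤ᵇ toℕ i) ∧ lookup I i then 1 else 0

sum-allFin-suc : ∀ {n} (f : Fin (suc n) → ℕ) →
  sum (map f (allFin (suc n))) ≡ f Fin.zero + sum (map (f ∘ Fin.suc) (allFin n))
sum-allFin-suc {n} f = cong (λ l → f Fin.zero + sum l)
  (trans (List.map-tabulate Fin.suc f) (sym (List.map-tabulate (λ i → i) (f ∘ Fin.suc))))

suc-≤ᵇ-suc : ∀ k t → (suc k ≤ᵇ suc t) ≡ (k ≤ᵇ t)
suc-≤ᵇ-suc zero t = refl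
suc-≤ᵇ-suc (suc k) t = refl

sum-member≥ : ∀ {n} (I : Subset n) k → sum (map (member≥ I k) (allFin n)) ≡ suffix I k
sum-member≥ [] k = refl
sum-member≥ (p ∷ I) zero =
  trans (sum-allFin-suc (member≥ (p ∷ I) zero)) (cong₂ _+_ (head p) (sum-member≥ I zero))
  where
  head : ∀ p → (if p then 1 else 0) ≡ bit p
  head true = refl
  head false = refl
sum-member≥ (p ∷ I) (suc k) =
  trans (sum-allFin-suc (member≥ (p ∷ I) (suc k)))
    (trans (cong sum (List.map-cong shift (allFin _))) (sum-member≥ I k))
  where
  shift : ∀ i → member≥ (p ∷ I) (suc k) (Fin.suc i) ≡ member≥ I k i
  shift i = cong (λ c → if c ∧ lookup I i then 1 else 0) (suc-≤ᵇ-suc k (toℕ i))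

suffixCount≡suffix : ∀ {n} (I : Subset n) j → suffixCount I j ≡ suffix I (toℕ j)
suffixCount≡suffix I j = sum-member≥ I (toℕ j)

_⊑_ : ∀ {n} → Subset n → Subset n → Set
_⊑_ {n} I J = ∀ (j : Fin n) → suffix I (toℕ j) ≤ suffix J (toℕ j)

≤L⇒⊑ : ∀ {n} (I J : Subset n) → I ≤L J → I ⊑ J
≤L⇒⊑ I J I≤J j = subst₂ _≤_ (suffixCount≡suffix I j) (suffixCount≡suffix J j) (I≤J j)

⊑⇒≤L : ∀ {n} (I J : Subset n) → I ⊑ J → I ≤L J
⊑⇒≤L I J I⊑J j =
  subst₂ _≤_ (sym (suffixCount≡suffix I j)) (sym (suffixCount≡suffix J j)) (I⊑J j)

≤L-refl : ∀ {n} (I : Subset n) → I ≤L I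
≤L-refl I j = ≤-refl

≤L-trans : ∀ {n} (I J K : Subset n) → I ≤L J → J ≤L K → I ≤L K
≤L-trans I J K I≤J J≤K j = ≤-trans (I≤J j) (J≤K j)

Close : ∀ {n} → Subset n → Subset n → Set
Close {n} x y = ∀ (j : Fin n) → suffix y (toℕ j) ≤ suc (suffix x (toℕ j))

close-refl : ∀ {n} (x : Subset n) → Close x x
close-refl x j = n≤1+n _

close-⊑ : ∀ {n} (x y z : Subset n) → z ⊑ y → Close x y → Close x z
close-⊑ x y z z⊑y y-close j = ≤-trans (z⊑y j) (y-close j)

capped : ∀ {n} → Subset n → Subset n → ℕ → ℕ
capped y x k = suffix y k ⊓ suc (suffix x k)

-- The truncation contains position k exactly when the capped profile jumps there.
truncate : ∀ {n} → Subset n → Subset n → Subset n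
truncate [] [] = []
truncate (p ∷ y) (q ∷ x) = does (capped y x 0 <? capped (p ∷ y) (q ∷ x) 0) ∷ truncate y x

bit-step : ∀ {m M} → m ≤ M → M ≤ suc m → bit (does (m <? M)) + m ≡ M
bit-step {m} {M} m≤M M≤1+m = step (m <? M)
  where
  step : (m<?M : Dec (m < M)) → bit (does m<?M) + m ≡ M
  step (yes m<M) = ≤-antisym m<M M≤1+m
  step (no m≮M) = ≤-antisym m≤M (≮⇒≥ m≮M)

suffix-truncate : ∀ {n} (y x : Subset n) k → suffix (truncate y x) k ≡ capped y x k
suffix-truncate [] [] k = refl
suffix-truncate (p ∷ y) (q ∷ x) (suc k) = suffix-truncate y x k
suffix-truncate (p ∷ y) (q ∷ x) zero =
  trans (cong (bit (does (capped y x 0 <? capped (p ∷ y) (q ∷ x) 0)) +_) (suffix-truncate y x 0))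
    (bit-step (⊓-mono-≤ (suffix-grows p y) (s≤s (suffix-grows q x)))
              (⊓-mono-≤ (suffix-step p y) (s≤s (suffix-step q x))))

truncate-⊑ : ∀ {n} (y x : Subset n) → truncate y x ⊑ y
truncate-⊑ y x j rewrite suffix-truncate y x (toℕ j) = m⊓n≤m _ _

truncate-close : ∀ {n} (y x : Subset n) → Close x (truncate y x)
truncate-close y x j rewrite suffix-truncate y x (toℕ j) = m⊓n≤n _ _

truncate-greatest : ∀ {n} (y x z : Subset n) → z ⊑ y → Close x z → z ⊑ truncate y x
truncate-greatest y x z z⊑y z-close j
  rewrite suffix-truncate y x (toℕ j) = ⊓-glb (z⊑y j) (z-close j)

truncate-fixed : ∀ {n} (y x : Subset n) → x ≡ truncate y x → Close x y
truncate-fixed y x x≡b j =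
  below-cap (trans (cong (λ w → suffix w (toℕ j)) x≡b) (suffix-truncate y x (toℕ j)))
  where
  below-cap : ∀ {a c} → c ≡ a ⊓ suc c → a ≤ suc c
  below-cap {a} {c} c≡a⊓1+c with ⊓-sel a (suc c)
  ... | inj₁ a⊓1+c≡a = subst₂ _≤_ (trans c≡a⊓1+c a⊓1+c≡a) refl (n≤1+n c)
  ... | inj₂ a⊓1+c≡1+c = contradiction (sym (trans c≡a⊓1+c a⊓1+c≡1+c)) 1+n≢n

-- rank I = Σ_k #(I ∩ [k,n]); it is strictly monotone, so it bounds chains.
rank : ∀ {n} → Subset n → ℕ
rank [] = 0
rank (p ∷ I) = suffix (p ∷ I) 0 + rank I

⊑-tail : ∀ {n} {p q} {I J : Subset n} → (p ∷ I) ⊑ (q ∷ J) → I ⊑ J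
⊑-tail pI⊑qJ j = pI⊑qJ (Fin.suc j)

rank-mono : ∀ {n} (I J : Subset n) → I ⊑ J → rank I ≤ rank J
rank-mono [] [] I⊑J = z≤n
rank-mono (p ∷ I) (q ∷ J) pI⊑qJ = +-mono-≤ (pI⊑qJ Fin.zero) (rank-mono I J (⊑-tail pI⊑qJ))

rank-strict : ∀ {n} (I J : Subset n) → I ⊑ J → I ≢ J → rank I < rank J
rank-strict [] [] I⊑J I≢J = contradiction refl I≢J
rank-strict (p ∷ I) (q ∷ J) pI⊑qJ pI≢qJ with ≡-dec Bool._≟_ I J
... | no I≢J = +-mono-≤-< (pI⊑qJ Fin.zero) (rank-strict I J (⊑-tail pI⊑qJ) I≢J)
... | yes refl = +-mono-<-≤ (head-strict p q (pI⊑qJ Fin.zero) (pI≢qJ ∘ cong (_∷ I)))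
                            (rank-mono I I (λ j → ≤-refl))
  where
  head-strict : ∀ p q → bit p + suffix I 0 ≤ bit q + suffix I 0 → p ≢ q →
                bit p + suffix I 0 < bit q + suffix I 0
  head-strict false false _ p≢q = contradiction refl p≢q
  head-strict true true _ p≢q = contradiction refl p≢q
  head-strict false true _ _ = ≤-refl
  head-strict true false 1+s≤s _ = contradiction 1+s≤s 1+n≰n

_⊏_ : ∀ {n} → Subset n → Subset n → Set
_⊏_ = _<_ on rank

⊏-wellFounded : ∀ {n} → WellFounded (_⊏_ {n})
⊏-wellFounded = On.wellFounded rank <-wellFounded

Σ[_]_ : {A : Set} → List A → (A → ℤ) → ℤ
Σ[ L ] f = foldr _+ℤ_ 0ℤ (map f L)

Σ-++ : {A : Set} (K L : List A) (f : A → ℤ) → Σ[ K ++ L ] f ≡ Σ[ K ] f +ℤ Σ[ L ] f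
Σ-++ List.[] L f = sym (ℤ.+-identityˡ _)
Σ-++ (a List.∷ K) L f = trans (cong (f a +ℤ_) (Σ-++ K L f)) (sym (ℤ.+-assoc (f a) _ _))

Σ-map : {A B : Set} (L : List A) (g : A → B) (f : B → ℤ) → Σ[ map g L ] f ≡ Σ[ L ] (f ∘ g)
Σ-map L g f = cong (foldr _+ℤ_ 0ℤ) (sym (List.map-∘ L))

Σ-+ : {A : Set} (L : List A) (f g : A → ℤ) → Σ[ L ] (λ a → f a +ℤ g a) ≡ Σ[ L ] f +ℤ Σ[ L ] g
Σ-+ List.[] f g = refl
Σ-+ (a List.∷ L) f g = trans (cong ((f a +ℤ g a) +ℤ_) (Σ-+ L f g)) (interchange (f a) (g a) _ _)

Σ-zero : {A : Set} (L : List A) (f : A → ℤ) → (∀ a → f a ≡ 0ℤ) → Σ[ L ] f ≡ 0ℤ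
Σ-zero List.[] f f≡0 = refl
Σ-zero (a List.∷ L) f f≡0 = cong₂ _+ℤ_ (f≡0 a) (Σ-zero L f f≡0)

Σ-allSubsets-suc : ∀ n (f : Subset (suc n) → ℤ) →
  Σ[ allSubsets (suc n) ] f
    ≡ Σ[ allSubsets n ] (f ∘ (outside ∷_)) +ℤ Σ[ allSubsets n ] (f ∘ (inside ∷_))
Σ-allSubsets-suc n f =
  trans (Σ-++ (map (outside ∷_) (allSubsets n)) (map (inside ∷_) (allSubsets n)) f)
        (cong₂ _+ℤ_ (Σ-map (allSubsets n) (outside ∷_) f) (Σ-map (allSubsets n) (inside ∷_) f))

-- A function vanishing off a single subset y sums to its value at y
-- (allSubsets enumerates every subset exactly once).
Σ-single : ∀ n (f : Subset n → ℤ) (y : Subset n) → (∀ z → z ≢ y → f z ≡ 0ℤ) →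
  Σ[ allSubsets n ] f ≡ f y
Σ-single zero f [] f-off-y = ℤ.+-identityʳ (f [])
Σ-single (suc n) f (false ∷ y) f-off-y = begin
  Σ[ allSubsets (suc n) ] f                                  ≡⟨ Σ-allSubsets-suc n f ⟩
  Σ[ subsets ] (f ∘ (false ∷_)) +ℤ Σ[ subsets ] (f ∘ (true ∷_))
    ≡⟨ cong₂ _+ℤ_ (Σ-single n (f ∘ (false ∷_)) y (λ z z≢y → f-off-y _ (z≢y ∘ ∷-injectiveʳ)))
                   (Σ-zero subsets (f ∘ (true ∷_)) (λ z → f-off-y _ (λ ()))) ⟩
  f (false ∷ y) +ℤ 0ℤ                                       ≡⟨ ℤ.+-identityʳ _ ⟩
  f (false ∷ y)                                              ∎
  where
  open ≡-Reasoning
  subsets : List (Subset n)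
  subsets = allSubsets n
Σ-single (suc n) f (true ∷ y) f-off-y = begin
  Σ[ allSubsets (suc n) ] f                                  ≡⟨ Σ-allSubsets-suc n f ⟩
  Σ[ subsets ] (f ∘ (false ∷_)) +ℤ Σ[ subsets ] (f ∘ (true ∷_))
    ≡⟨ cong₂ _+ℤ_ (Σ-zero subsets (f ∘ (false ∷_)) (λ z → f-off-y _ (λ ())))
                   (Σ-single n (f ∘ (true ∷_)) y (λ z z≢y → f-off-y _ (z≢y ∘ ∷-injectiveʳ))) ⟩
  0ℤ +ℤ f (true ∷ y)                                        ≡⟨ ℤ.+-identityˡ _ ⟩
  f (true ∷ y)                                               ∎
  where
  open ≡-Reasoning
  subsets : List (Subset n)
  subsets = allSubsets n

indicator-split : ∀ {P Q C : Set} (p? : Dec P) (q? : Dec Q) (c? : Dec C) (m : ℤ) → (C → Q) →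
  (if does p? ∧ does q? then m else 0ℤ)
    ≡ (if does p? ∧ does c? then m else 0ℤ) +ℤ (if does p? ∧ does q? ∧ not (does c?) then m else 0ℤ)
indicator-split (no _) q? c? m C⇒Q = refl
indicator-split (yes _) q? (yes c) m C⇒Q rewrite dec-true q? (C⇒Q c) = sym (ℤ.+-identityʳ m)
indicator-split (yes _) (yes _) (no _) m C⇒Q = sym (ℤ.+-identityˡ m)
indicator-split (yes _) (no _) (no _) m C⇒Q = refl

rim-zero : ∀ {P Q C : Set} (p? : Dec P) (q? : Dec Q) (c? : Dec C) (m : ℤ) → (P → Q → ¬ C → m ≡ 0ℤ) →
  (if does p? ∧ does q? ∧ not (does c?) then m else 0ℤ) ≡ 0ℤ
rim-zero (yes p) (yes q) (no ¬c) m m≡0 = m≡0 p q ¬c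
rim-zero (yes _) (yes _) (yes _) m m≡0 = refl
rim-zero (yes _) (no _) c? m m≡0 = refl
rim-zero (no _) q? c? m m≡0 = refl

rim : ∀ {n} → (Subset n → Subset n → ℤ) → (x b y z : Subset n) → ℤ
rim μ x b y z = if does (x ≤L? z) ∧ does (z ≤L? y) ∧ not (does (z ≤L? b)) then μ x z else 0ℤ

interval-split : ∀ {n} (μ : Subset n → Subset n → ℤ) (x b y : Subset n) → b ≤L y →
  intervalSum μ x y ≡ intervalSum μ x b +ℤ Σ[ allSubsets n ] (rim μ x b y)
interval-split {n} μ x b y b≤y =
  trans (cong (foldr _+ℤ_ 0ℤ) (List.map-cong split (allSubsets n))) (Σ-+ (allSubsets n) _ _)
  where
  term : Subset n → Subset n → ℤ
  term w z = if does (x ≤L? z) ∧ does (z ≤L? w) then μ x z else 0ℤ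

  split : ∀ z → term y z ≡ term b z +ℤ rim μ x b y z
  split z = indicator-split (x ≤L? z) (z ≤L? y) (z ≤L? b) (μ x z) (λ z≤b → ≤L-trans z b y z≤b b≤y)

module Vanishing {n} (μ : Subset n → Subset n → ℤ)
  (interval-zero : ∀ x y → x ≤L y → x ≢ y → intervalSum μ x y ≡ 0ℤ) (x : Subset n) where

  vanishing-acc : ∀ y → Acc _⊏_ y → x ≤L y → ¬ Close x y → μ x y ≡ 0ℤ
  vanishing-acc y (acc smaller) x≤y y-far = begin
    μ x y                                         ≡⟨ sym rim-at-y ⟩
    rim μ x b y y                                 ≡⟨ sym (Σ-single n (rim μ x b y) y rim-off-y) ⟩
    Σ[ allSubsets n ] (rim μ x b y)               ≡⟨ sym (ℤ.+-identityˡ _) ⟩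
    0ℤ +ℤ Σ[ allSubsets n ] (rim μ x b y)
      ≡⟨ cong (_+ℤ Σ[ allSubsets n ] (rim μ x b y)) (sym (interval-zero x b x≤b x≢b)) ⟩
    intervalSum μ x b +ℤ Σ[ allSubsets n ] (rim μ x b y)
      ≡⟨ sym (interval-split μ x b y b≤y) ⟩
    intervalSum μ x y                             ≡⟨ interval-zero x y x≤y x≢y ⟩
    0ℤ                                            ∎
    where
    open ≡-Reasoning
    b : Subset n
    b = truncate y x

    b≤y : b ≤L y
    b≤y = ⊑⇒≤L b y (truncate-⊑ y x)

    x≤b : x ≤L b
    x≤b = ⊑⇒≤L x b (truncate-greatest y x x (≤L⇒⊑ x y x≤y) (close-refl x))

    x≢b : x ≢ b
    x≢b x≡b = y-far (truncate-fixed y x x≡b)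

    x≢y : x ≢ y
    x≢y refl = y-far (close-refl x)

    -- y itself lies in the rim, since everything below b is close to x
    y≰b : ¬ y ≤L b
    y≰b y≤b = y-far (close-⊑ x b y (≤L⇒⊑ y b y≤b) (truncate-close y x))

    rim-at-y : rim μ x b y y ≡ μ x y
    rim-at-y rewrite dec-true (x ≤L? y) x≤y | dec-true (y ≤L? y) (≤L-refl y)
                   | dec-false (y ≤L? b) y≰b = refl

    -- any other z in the rim is strictly below y and not close to x
    rim-off-y : ∀ z → z ≢ y → rim μ x b y z ≡ 0ℤ
    rim-off-y z z≢y = rim-zero (x ≤L? z) (z ≤L? y) (z ≤L? b) (μ x z) λ x≤z z≤y z≰b →
      vanishing-acc z (smaller (rank-strict z y (≤L⇒⊑ z y z≤y) z≢y)) x≤z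
        (λ z-close → z≰b (⊑⇒≤L z b (truncate-greatest y x z (≤L⇒⊑ z y z≤y) z-close)))

  vanishing : ∀ y → x ≤L y → ¬ Close x y → μ x y ≡ 0ℤ
  vanishing y = vanishing-acc y (⊏-wellFounded y)

within-one : ∀ {a t} → a ≤ t → t ≤ suc a → t ≡ a ⊎ t ≡ suc a
within-one a≤t t≤1+a with m≤n⇒m<n∨m≡n a≤t
... | inj₁ a<t = inj₂ (≤-antisym t≤1+a a<t)
... | inj₂ a≡t = inj₁ (sym a≡t)

corollary3p8 : (n : ℕ) → 1 ≤ n → (μ : Subset n → Subset n → ℤ) → IsMobius n μ →
    (S T : Subset n) → ¬ (∣ T ∣ ≡ ∣ S ∣) → ¬ (∣ T ∣ ≡ suc ∣ S ∣) → μ S T ≡ ℤ.+ 0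
corollary3p8 (suc _) _ μ (_ , off-order , interval-zero) S T ∣T∣≢∣S∣ ∣T∣≢1+∣S∣ with S ≤L? T
... | no S≰T = off-order S T S≰T
... | yes S≤T = Vanishing.vanishing μ interval-zero S T S≤T T-far
  where
  -- closeness at the first position would force #T ∈ {#S, #S + 1}
  T-far : ¬ Close S T
  T-far T-close with within-one (≤L⇒⊑ S T S≤T Fin.zero) (T-close Fin.zero)
  ... | inj₁ t≡s = ∣T∣≢∣S∣ (trans (∣∣≡suffix T) (trans t≡s (sym (∣∣≡suffix S))))
  ... | inj₂ t≡1+s = ∣T∣≢1+∣S∣ (trans (∣∣≡suffix T) (trans t≡1+s (cong suc (sym (∣∣≡suffix S)))))
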